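{- Consider $\mathcal{R}$-Wythoff, whose moves are of the following types, for each positive integer $k$: type $L_k$, remove $k$ tokens from the larger pile (or from either pile if the piles are equal); and type $D_k$, remove $k$ tokens from both piles. For every nonempty set $T$ of these move types, the game obtained from $\mathcal{R}$-Wythoff by forbidding all moves of types in $T$ (from every position) does not have the same set of $\mathcal{P}$-positions as $\mathcal{R}$-Wythoff. Equivalently, no restriction of $\mathcal{R}$-Wythoff preserves its $\mathcal{P}$-positions.
   Context: A position is an unordered pair $(a,b)$ of nonnegative integers (pile sizes). Two players alternate; the player making the last move wins. $\mathcal{R}$-Wythoff: a move either removes a positive number of tokens from the larger pile (or from either pile if both piles have equal size), or removes the same positive number of tokens from both piles. A $\mathcal{P}$-position is a position from which the player about to move cannot force a win. The $\mathcal{P}$-positions of $\mathcal{R}$-Wythoff are $\{(\lfloor \phi n\rfloor, \lfloor \phi n\rfloor+n): n\ge 0\}$ with $\phi=(1+\sqrt5)/2$. A restriction of a game is a game obtained by eliminating some of its moves. -}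

module Defs where

open import Data.Nat using (ℕ; _≤_; _∸_)
open import Data.Product using (Σ; _×_; _,_)
open import Data.Empty using (⊥)
open import Relation.Nullary using (¬_)

-- Unordered pairs are represented by
-- ordered pairs (a , b); every move rule below is symmetric in the two
-- piles, so the game (and its P-positions) is invariant under swapping.
Position : Set
Position = ℕ × ℕ

-- Move types: L k (remove k from the larger pile, or from either pile if
-- equal) and D k (remove k from both piles).  Only k ≥ 1 are genuine move
-- types; see IsMoveType.
data MoveType : Set where
  L : ℕ → MoveType
  D : ℕ → MoveType

IsMoveType : MoveType → Set
IsMoveType (L k) = 1 ≤ k
IsMoveType (D k) = 1 ≤ k

data Step : MoveType → Position → Position → Set where
  stepL₁ : ∀ {k a b} → 1 ≤ k → k ≤ a → b ≤ a → Step (L k) (a , b) (a ∸ k , b)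
  stepL₂ : ∀ {k a b} → 1 ≤ k → k ≤ b → a ≤ b → Step (L k) (a , b) (a , b ∸ k)
  stepD  : ∀ {k a b} → 1 ≤ k → k ≤ a → k ≤ b → Step (D k) (a , b) (a ∸ k , b ∸ k)

Move : (T : MoveType → Set) → Position → Position → Set
Move T p q = Σ MoveType (λ t → ¬ T t × Step t p q)

mutual
  data Win (T : MoveType → Set) (p : Position) : Set where
    win : (q : Position) → Move T p q → Lose T q → Win T p

  data Lose (T : MoveType → Set) (p : Position) : Set where
    lose : ((q : Position) → Move T p q → Win T q) → Lose T p

IsP : (T : MoveType → Set) → Position → Set
IsP T p = ¬ Win T p

NoneForbidden : MoveType → Set
NoneForbidden _ = ⊥

module Submission where

-- Idea.  Let 𝒫 be the set of P-positions of R-Wythoff.  Suppose moves of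
-- type t are forbidden.  If some position p ∉ 𝒫 has a move of type t into
-- 𝒫 and no move of any other type into 𝒫, then in the restricted game every
-- remaining move from p leads outside 𝒫; if the restricted game had the same
-- P-positions, those targets would be N-positions there, so p would become a
-- P-position of the restricted game although p ∉ 𝒫.  Hence it suffices to
-- exhibit, for every move type, such a position with a sole winning move:
--   L k :  (k , 0);
--   D k :  (k , k)         when k = aₘ,
--          (k+1 , k+2)     when k = bₘ   (the D-move leads to (a₁ , b₁)).

open import Defs
open import Data.Nat
open import Data.Nat.Properties
open import Data.Nat.Induction using (<-wellFounded)
open import Data.List using (List; []; _∷_)
open import Data.List.Extrema.Nat using (max; xs≤max)
open import Data.List.Membership.Propositional using (_∈_; _∉_)
open import Data.List.Membership.DecPropositional _≟_ using (_∈?_)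
import Data.List.Relation.Unary.All as ListAll
open import Data.List.Relation.Unary.Any using (here; there)
open import Data.Product using (Σ; _×_; _,_; proj₁; proj₂; swap)
open import Data.Sum as Sum using (_⊎_; inj₁; inj₂)
open import Data.Empty using (⊥; ⊥-elim)
open import Function.Base using (_∘_)
open import Function.Bundles using (_⇔_; Equivalence)
open import Induction.WellFounded using (module All)
open import Relation.Binary.Definitions using (tri<; tri≈; tri>)
open import Relation.Binary.PropositionalEquality
open import Relation.Nullary using (¬_; yes; no)
open import Relation.Unary using (Decidable)
import Relation.Binary.Construct.On as On

pile-nonempty : ∀ {k x} → 1 ≤ k → k ≤ x → x ≢ 0
pile-nonempty 1≤k k≤x refl = <-irrefl refl (≤-trans 1≤k k≤x)

pile-shrinks : ∀ {k x} → 1 ≤ k → k ≤ x → x ∸ k < x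
pile-shrinks {k} {x} 1≤k k≤x = ∸-monoʳ-< {x} {k} {0} 1≤k k≤x

summand-vanishes : ∀ m {n} → m + n ≤ m → n ≡ 0
summand-vanishes m {n} le =
  n≤0⇒n≡0 (+-cancelˡ-≤ m n 0 (≤-trans le (≤-reflexive (sym (+-identityʳ m)))))

-- 1. Minimum excludant

LeastFailure : (ℕ → Set) → Set
LeastFailure P = Σ ℕ λ y → ¬ P y × (∀ {z} → z < y → P z)

scan : ∀ {P : ℕ → Set} → Decidable P → ∀ n → (∀ {z} → z < n → P z) ⊎ LeastFailure P
scan P? zero = inj₁ λ ()
scan {P} P? (suc n) with scan P? n | P? n
... | inj₂ least | _ = inj₂ least
... | inj₁ below | no ¬Pn = inj₂ (n , ¬Pn , below)
... | inj₁ below | yes Pn = inj₁ λ z<1+n → case-split (m<1+n⇒m<n∨m≡n z<1+n)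
  where
  case-split : ∀ {z} → z < n ⊎ z ≡ n → P z
  case-split (inj₁ z<n) = below z<n
  case-split (inj₂ refl) = Pn

leastFailure : ∀ {P : ℕ → Set} → Decidable P → ∀ {w} → ¬ P w → LeastFailure P
leastFailure P? {w} ¬Pw with scan P? (suc w)
... | inj₁ below = ⊥-elim (¬Pw (below (n<1+n w)))
... | inj₂ least = least

above-max-∉ : ∀ xs → suc (max 0 xs) ∉ xs
above-max-∉ xs x∈xs = <-irrefl refl (ListAll.lookup (xs≤max 0 xs) x∈xs)

-- Only the two specification lemmas of mex are ever used, so its definition
-- is kept abstract (this also keeps the type checker from evaluating it).
abstract
  mex : List ℕ → ℕ
  mex xs = proj₁ (leastFailure (_∈? xs) (above-max-∉ xs))

  mex-∉ : ∀ xs → mex xs ∉ xs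
  mex-∉ xs = proj₁ (proj₂ (leastFailure (_∈? xs) (above-max-∉ xs)))

  mex-least : ∀ xs {y} → y < mex xs → y ∈ xs
  mex-least xs = proj₂ (proj₂ (leastFailure (_∈? xs) (above-max-∉ xs)))

-- 2. The Wythoff pairs

taken : ℕ → List ℕ
taken zero = []
taken (suc n) = let x = mex (taken n) in x ∷ x + n ∷ taken n

a : ℕ → ℕ
a n = mex (taken n)

b : ℕ → ℕ
b n = a n + n

Taken : ℕ → ℕ → Set
Taken n x = Σ ℕ λ i → i < n × (x ≡ a i ⊎ x ≡ b i)

∈taken⇒Taken : ∀ n {x} → x ∈ taken n → Taken n x
∈taken⇒Taken (suc n) (here x≡a) = n , n<1+n n , inj₁ x≡a
∈taken⇒Taken (suc n) (there (here x≡b)) = n , n<1+n n , inj₂ x≡b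
∈taken⇒Taken (suc n) (there (there x∈)) with ∈taken⇒Taken n x∈
... | i , i<n , x≡ = i , m<n⇒m<1+n i<n , x≡

Taken⇒∈taken : ∀ n {x} → Taken n x → x ∈ taken n
Taken⇒∈taken (suc n) (i , i<1+n , x≡) with m<1+n⇒m<n∨m≡n i<1+n | x≡
... | inj₂ refl | inj₁ x≡a = here x≡a
... | inj₂ refl | inj₂ x≡b = there (here x≡b)
... | inj₁ i<n | _ = there (there (Taken⇒∈taken n (i , i<n , x≡)))

a-fresh : ∀ n → ¬ Taken n (a n)
a-fresh n t = mex-∉ (taken n) (Taken⇒∈taken n t)

a-least : ∀ n {x} → x < a n → Taken n x
a-least n x<a = ∈taken⇒Taken n (mex-least (taken n) x<a)

a-step : ∀ n → a n < a (suc n)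
a-step n = ≰⇒> λ le → a-fresh (suc n) (taken-below le)
  where
  taken-below : a (suc n) ≤ a n → Taken (suc n) (a (suc n))
  taken-below le with m≤n⇒m<n∨m≡n le
  ... | inj₂ eq = n , n<1+n n , inj₁ eq
  ... | inj₁ lt with a-least n lt
  ...   | i , i<n , eq = i , m<n⇒m<1+n i<n , eq

a-mono : ∀ {i n} → i < n → a i < a n
a-mono {i} {suc n} i<1+n with m<1+n⇒m<n∨m≡n i<1+n
... | inj₁ i<n = <-trans (a-mono i<n) (a-step n)
... | inj₂ refl = a-step n

a-injective : ∀ {i n} → a i ≡ a n → i ≡ n
a-injective {i} {n} eq with <-cmp i n
... | tri< i<n _ _ = ⊥-elim (<⇒≢ (a-mono i<n) eq)
... | tri≈ _ i≡n _ = i≡n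
... | tri> _ _ n<i = ⊥-elim (<⇒≢ (a-mono n<i) (sym eq))

n≤a : ∀ n → n ≤ a n
n≤a zero = z≤n
n≤a (suc n) = ≤-<-trans (n≤a n) (a-step n)

a≤b : ∀ n → a n ≤ b n
a≤b n = m≤m+n (a n) n

a-zero : a 0 ≡ 0
a-zero = n≤0⇒n≡0 (≮⇒≥ λ 0<a → nothing-taken (a-least 0 0<a))
  where
  nothing-taken : ¬ Taken 0 0
  nothing-taken (_ , () , _)

b-zero : b 0 ≡ 0
b-zero = trans (+-identityʳ (a 0)) a-zero

a-one : a 1 ≡ 1
a-one = ≤-antisym (≮⇒≥ λ 1<a → one-untaken (a-least 1 1<a))
                  (subst (_< a 1) a-zero (a-step 0))
  where
  one-untaken : ¬ Taken 1 1
  one-untaken (zero , _ , inj₁ 1≡a₀) = 1+n≢n (trans 1≡a₀ a-zero)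
  one-untaken (zero , _ , inj₂ 1≡b₀) = 1+n≢n (trans 1≡b₀ b-zero)
  one-untaken (suc _ , s≤s () , _)

ab-disjoint : ∀ {n m} → a n ≡ b m → n ≡ 0 × m ≡ 0
ab-disjoint {n} {m} eq with <-cmp m n
... | tri< m<n _ _ = ⊥-elim (a-fresh n (m , m<n , inj₂ eq))
... | tri≈ _ refl _ = let n≡0 = summand-vanishes (a n) (≤-reflexive (sym eq)) in n≡0 , n≡0
... | tri> _ _ n<m = ⊥-elim (<⇒≢ (<-≤-trans (a-mono n<m) (a≤b m)) eq)

cover : ∀ x → Σ ℕ λ n → x ≡ a n ⊎ x ≡ b n
cover x with a-least (suc x) (n≤a (suc x))
... | n , _ , x≡ = n , x≡

b-gap : ∀ {i n} → i < n → suc (b i) < b n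
b-gap {i} {n} i<n =
  subst (_≤ b n) (cong suc (+-suc (a i) i)) (+-mono-≤ (a-mono i<n) i<n)

b-not-adjacent : ∀ m n → suc (b m) ≢ b n
b-not-adjacent m n eq with <-cmp m n
... | tri< m<n _ _ = <⇒≢ (b-gap m<n) eq
... | tri≈ _ refl _ = 1+n≢n eq
... | tri> _ _ n<m = <-asym (<-trans (n<1+n (b n)) (b-gap n<m)) (subst (b m <_) eq (n<1+n (b m)))

-- 3. The P-positions of R-Wythoff

WythoffPair : ℕ → ℕ → Set
WythoffPair x y = Σ ℕ λ n → x ≡ a n × y ≡ b n

WythoffP : Position → Set
WythoffP (x , y) = WythoffPair x y ⊎ WythoffPair y x

wythoffP-swap : ∀ {p} → WythoffP p → WythoffP (swap p)
wythoffP-swap {_ , _} = Sum.swap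

wythoffP-ordered : ∀ {x y} → WythoffP (x , y) → x ≤ y → WythoffPair x y
wythoffP-ordered (inj₁ pair) _ = pair
wythoffP-ordered (inj₂ (n , refl , refl)) bₙ≤aₙ with summand-vanishes (a n) bₙ≤aₙ
... | refl = 0 , +-identityʳ (a 0) , sym (+-identityʳ (a 0))

wythoffP-difference : ∀ {x y d} → WythoffP (x , y) → x + d ≡ y → x ≡ a d
wythoffP-difference {x} {d = d} w refl with wythoffP-ordered w (m≤m+n x d)
... | n , refl , aₙ+d≡bₙ = cong a (sym (+-cancelˡ-≡ (a n) d n aₙ+d≡bₙ))

wythoffP-diagonal : ∀ {x} → WythoffP (x , x) → x ≡ 0
wythoffP-diagonal {x} w = trans (wythoffP-difference w (+-identityʳ x)) a-zero

wythoffP-axis : ∀ {x} → WythoffP (x , 0) → x ≡ 0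
wythoffP-axis {x} w =
  n≤0⇒n≡0 (≤-trans (n≤a x) (≤-reflexive (sym (wythoffP-difference (wythoffP-swap w) refl))))

step-swap : ∀ {t p q} → Step t p q → Step t (swap p) (swap q)
step-swap (stepL₁ 1≤k k≤x y≤x) = stepL₂ 1≤k k≤x y≤x
step-swap (stepL₂ 1≤k k≤y x≤y) = stepL₁ 1≤k k≤y x≤y
step-swap (stepD 1≤k k≤x k≤y) = stepD 1≤k k≤y k≤x

-- By symmetry start from (aₙ , bₙ): removing
-- from bₙ alone would hit a second pair with first pile aₙ, and a diagonal
-- move keeps the difference n, whose pair is unique.
no-step-from-pair : ∀ n {t q} → Step t (a n , b n) q → ¬ WythoffP q
no-step-from-pair n (stepL₁ 1≤k k≤aₙ bₙ≤aₙ) _ with summand-vanishes (a n) bₙ≤aₙ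
... | refl = pile-nonempty 1≤k k≤aₙ a-zero
no-step-from-pair n (stepL₂ 1≤k k≤bₙ _) (inj₁ (m , aₙ≡aₘ , bₙ∸k≡bₘ))
  with a-injective aₙ≡aₘ
... | refl = <⇒≢ (pile-shrinks 1≤k k≤bₙ) bₙ∸k≡bₘ
no-step-from-pair n (stepL₂ 1≤k k≤bₙ _) (inj₂ (m , _ , aₙ≡bₘ))
  with ab-disjoint aₙ≡bₘ
... | refl , _ = pile-nonempty 1≤k k≤bₙ b-zero
no-step-from-pair n (stepD {k} 1≤k k≤aₙ _) w =
  <⇒≢ (pile-shrinks 1≤k k≤aₙ) (wythoffP-difference w (sym (+-∸-comm n k≤aₙ)))

no-step-within : ∀ {t p q} → WythoffP p → Step t p q → ¬ WythoffP q
no-step-within (inj₁ (n , refl , refl)) st = no-step-from-pair n st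
no-step-within (inj₂ (n , refl , refl)) st wq =
  no-step-from-pair n (step-swap st) (wythoffP-swap wq)

stepL-to : ∀ {x y z} → z < y → x ≤ y → Step (L (y ∸ z)) (x , y) (x , z)
stepL-to {x} {y} {z} z<y x≤y =
  subst (λ w → Step (L (y ∸ z)) (x , y) (x , w)) (m∸[m∸n]≡n (<⇒≤ z<y))
        (stepL₂ (m<n⇒0<n∸m z<y) (m∸n≤m y z) x≤y)

stepD-to : ∀ {x z d} → z < x → Step (D (x ∸ z)) (x , x + d) (z , z + d)
stepD-to {x} {z} {d} z<x =
  subst₂ (λ u v → Step (D (x ∸ z)) (x , x + d) (u , v)) x∸k≡z x+d∸k≡z+d
         (stepD (m<n⇒0<n∸m z<x) k≤x (≤-trans k≤x (m≤m+n x d)))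
  where
  k≤x : x ∸ z ≤ x
  k≤x = m∸n≤m x z
  x∸k≡z : x ∸ (x ∸ z) ≡ z
  x∸k≡z = m∸[m∸n]≡n (<⇒≤ z<x)
  x+d∸k≡z+d : x + d ∸ (x ∸ z) ≡ z + d
  x+d∸k≡z+d = trans (+-∸-comm d k≤x) (cong (_+ d) x∸k≡z)

StepIntoP : Position → Set
StepIntoP p = Σ Position λ q → Σ MoveType λ t → Step t p q × WythoffP q

-- From outside 𝒫 there is a move into 𝒫.  For (x , x + d): if x = bₙ take
-- the larger pile down to aₙ; if x = aₙ take it down to bₙ when d > n, and
-- move diagonally to (a_d , b_d) when d < n.
step-into-P-ordered : ∀ x d → ¬ WythoffP (x , x + d) → StepIntoP (x , x + d)
step-into-P-ordered x d ∉P with cover x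
... | n , inj₂ refl =
  (b n , a n) , L _ , stepL-to aₙ<y (m≤m+n (b n) d) , inj₂ (n , refl , refl)
  where
  aₙ<y : a n < b n + d
  aₙ<y = ≤∧≢⇒< (≤-trans (a≤b n) (m≤m+n (b n) d)) λ eq → ∉P (inj₂ (n , sym eq , refl))
... | n , inj₁ refl with <-cmp d n
...   | tri< d<n _ _ = (a d , b d) , D _ , stepD-to (a-mono d<n) , inj₁ (d , refl , refl)
...   | tri≈ _ refl _ = ⊥-elim (∉P (inj₁ (d , refl , refl)))
...   | tri> _ _ n<d =
  (a n , b n) , L _ , stepL-to (+-monoʳ-< (a n) n<d) (m≤m+n (a n) d) , inj₁ (n , refl , refl)

step-into-P : ∀ p → ¬ WythoffP p → StepIntoP p
step-into-P (x , y) ∉P with ≤-total x y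
... | inj₁ x≤y with m≤n⇒∃[o]m+o≡n x≤y
...   | d , refl = step-into-P-ordered x d ∉P
step-into-P (x , y) ∉P | inj₂ y≤x with m≤n⇒∃[o]m+o≡n y≤x
... | d , refl with step-into-P-ordered y d (∉P ∘ wythoffP-swap)
...   | q , t , st , wq = swap q , t , step-swap st , wythoffP-swap wq

size : Position → ℕ
size (x , y) = x + y

step-shrinks : ∀ {t p q} → Step t p q → size q < size p
step-shrinks {p = x , y} (stepL₁ 1≤k k≤x _) = +-monoˡ-< y (pile-shrinks 1≤k k≤x)
step-shrinks {p = x , y} (stepL₂ 1≤k k≤y _) = +-monoʳ-< x (pile-shrinks 1≤k k≤y)
step-shrinks {p = x , y} (stepD {k} 1≤k k≤x _) =
  +-mono-<-≤ (pile-shrinks 1≤k k≤x) (m∸n≤m y k)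

Outcome : Position → Set
Outcome p = (WythoffP p → Lose NoneForbidden p) × (¬ WythoffP p → Win NoneForbidden p)

outcome : ∀ p → Outcome p
outcome = All.wfRec (On.wellFounded size <-wellFounded) _ Outcome step
  where
  step : ∀ p → (∀ {q} → size q < size p → Outcome q) → Outcome p
  step p ih = losing , winning
    where
    losing : WythoffP p → Lose NoneForbidden p
    losing ∈P = lose λ { q (_ , _ , st) →
      proj₂ (ih (step-shrinks st)) (no-step-within ∈P st) }
    winning : ¬ WythoffP p → Win NoneForbidden p
    winning ∉P with step-into-P p ∉P
    ... | q , t , st , ∈P = win q (t , (λ ()) , st) (proj₁ (ih (step-shrinks st)) ∈P)

outside-P-wins : ∀ p → ¬ WythoffP p → Win NoneForbidden p
outside-P-wins p = proj₂ (outcome p)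

-- 4. Restrictions

win-lose-exclusive : ∀ {T p} → Win T p → Lose T p → ⊥
win-lose-exclusive (win q move q-loses) (lose every-move-wins) =
  win-lose-exclusive (every-move-wins q move) q-loses

SoleWinningMove : MoveType → Position → Set
SoleWinningMove t p = ¬ WythoffP p × (∀ {t′ q} → Step t′ p q → WythoffP q → t′ ≡ t)

forbidding-sole-winning-move : (T : MoveType → Set) (t : MoveType) → T t →
  (p : Position) → SoleWinningMove t p →
  ¬ ((p : Position) → IsP T p ⇔ IsP NoneForbidden p)
forbidding-sole-winning-move T t Tt p (∉P , sole) same-P =
  Equivalence.to (same-P p) p-is-P (outside-P-wins p ∉P)
  where
  p-is-P : IsP T p
  p-is-P (win q (t′ , ¬Tt′ , st) q-loses) =
    Equivalence.to (same-P q) (λ q-wins → win-lose-exclusive q-wins q-loses)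
      (outside-P-wins q λ ∈P → ¬Tt′ (subst T (sym (sole st ∈P)) Tt))

sole-move-L : ∀ {k} → 1 ≤ k → SoleWinningMove (L k) (k , 0)
sole-move-L {k} 1≤k = (λ ∈P → pile-nonempty 1≤k ≤-refl (wythoffP-axis ∈P)) , sole
  where
  sole : ∀ {t q} → Step t (k , 0) q → WythoffP q → t ≡ L k
  sole (stepL₁ {j} _ j≤k _) ∈P = cong L (≤-antisym j≤k (m∸n≡0⇒m≤n (wythoffP-axis ∈P)))
  sole (stepL₂ () z≤n _) _
  sole (stepD () _ z≤n) _

sole-move-D-on-a : ∀ {k m} → 1 ≤ k → k ≡ a m → SoleWinningMove (D k) (k , k)
sole-move-D-on-a {k} {m} 1≤k k≡aₘ =
  (λ ∈P → pile-nonempty 1≤k ≤-refl (wythoffP-diagonal ∈P)) , sole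
  where
  k≢b : ∀ {x} → WythoffPair x k → ⊥
  k≢b (n , _ , k≡bₙ) with ab-disjoint (trans (sym k≡aₘ) k≡bₙ)
  ... | refl , _ = pile-nonempty 1≤k ≤-refl (trans k≡aₘ a-zero)
  sole : ∀ {t q} → Step t (k , k) q → WythoffP q → t ≡ D k
  sole (stepL₁ {j} _ _ _) ∈P = ⊥-elim (k≢b (wythoffP-ordered ∈P (m∸n≤m k j)))
  sole (stepL₂ {j} _ _ _) ∈P =
    ⊥-elim (k≢b (wythoffP-ordered (wythoffP-swap ∈P) (m∸n≤m k j)))
  sole (stepD {j} _ j≤k _) ∈P = cong D (≤-antisym j≤k (m∸n≡0⇒m≤n (wythoffP-diagonal ∈P)))

sole-move-D-on-b : ∀ {k m} → 1 ≤ k → k ≡ b m →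
  SoleWinningMove (D k) (suc k , suc (suc k))
sole-move-D-on-b {k} {m} 1≤k k≡bₘ = ∉P , sole
  where
  difference-one : ∀ {x y} → WythoffP (x , y) → x + 1 ≡ y → x ≡ 1
  difference-one w eq = trans (wythoffP-difference w eq) a-one
  ∉P : ¬ WythoffP (suc k , suc (suc k))
  ∉P ∈P = pile-nonempty 1≤k ≤-refl (suc-injective (difference-one ∈P (+-comm (suc k) 1)))
  sole : ∀ {t q} → Step t (suc k , suc (suc k)) q → WythoffP q → t ≡ D k
  sole (stepL₁ _ _ y≤x) _ = ⊥-elim (<-irrefl refl y≤x)
  sole (stepL₂ 1≤j _ _) ∈P with wythoffP-ordered (wythoffP-swap ∈P) (∸-monoʳ-≤ (suc (suc k)) 1≤j)
  ... | n , _ , 1+k≡bₙ = ⊥-elim (b-not-adjacent m n (trans (cong suc (sym k≡bₘ)) 1+k≡bₙ))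
  sole (stepD {j} _ j≤1+k _) ∈P = cong D (suc-injective (sym 1+k≡1+j))
    where
    difference : (suc k ∸ j) + 1 ≡ suc (suc k) ∸ j
    difference = trans (+-comm (suc k ∸ j) 1) (sym (+-∸-assoc 1 j≤1+k))
    1+k≡1+j : suc k ≡ suc j
    1+k≡1+j = trans (sym (m∸n+n≡m j≤1+k)) (cong (_+ j) (difference-one ∈P difference))

theorem2p3 : (T : MoveType → Set) → Σ MoveType (λ t → IsMoveType t × T t) →
    ¬ ((p : Position) → IsP T p ⇔ IsP NoneForbidden p)
theorem2p3 T (L k , 1≤k , Tt) = forbidding-sole-winning-move T (L k) Tt (k , 0) (sole-move-L 1≤k)
theorem2p3 T (D k , 1≤k , Tt) with cover k
... | m , inj₁ k≡aₘ = forbidding-sole-winning-move T (D k) Tt (k , k) (sole-move-D-on-a 1≤k k≡aₘ)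
... | m , inj₂ k≡bₘ =
  forbidding-sole-winning-move T (D k) Tt (suc k , suc (suc k)) (sole-move-D-on-b 1≤k k≡bₘ)
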